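{- Let $F$ be a digraph that is $\delta^+$-maderian and has the Erdős–Pósa Property. Then for every positive integer $k$, the digraph $k\times F$ is $\delta^+$-maderian.
   Context: Digraphs are finite, without loops or parallel arcs (directed 2-cycles allowed). A subdivision of a digraph $F$ is obtained by replacing each arc $(u,v)$ by a directed $(u,v)$-path of length at least 1, the paths being internally disjoint. A digraph $D$ contains a subdivision of $F$ if some subdigraph of $D$ is a subdivision of $F$. $\delta^+(D)$ is the minimum out-degree of $D$. A digraph $F$ is $\delta^+$-maderian if there exists an integer $c$ such that every digraph $D$ with $\delta^+(D)\ge c$ contains a subdivision of $F$; the least such $c$ is denoted $\mathrm{mad}_{\delta^+}(F)$. For a positive integer $k$, $k\times F$ denotes the disjoint union of $k$ copies of $F$. $F$ has the Erdős–Pósa Property if for every positive integer $k$ there exists $\phi(k)$ such that every digraph $D$ either contains a subdivision of $k\times F$, or has a set $S$ of at most $\phi(k)$ vertices such that $D-S$ contains no subdivision of $F$. -}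

module Defs where

open import Data.Nat using (ℕ; zero; suc; _+_; _≤_; _<_)
open import Data.Fin using (Fin; splitAt)
open import Data.Bool using (Bool; true; false; T)
open import Data.Sum using (_⊎_; inj₁; inj₂)
open import Data.Product using (Σ; _×_; _,_; ∃)
open import Data.List using (List; []; _∷_; _∷ʳ_; length; filter; allFin)
open import Data.List.Membership.Propositional using (_∈_; _∉_)
open import Data.List.Relation.Unary.Linked using (Linked)
open import Data.List.Relation.Unary.Unique.Propositional using (Unique)
open import Function.Definitions using (Injective)
open import Relation.Binary.PropositionalEquality using (_≡_)
open import Relation.Nullary using (¬_)

-- A finite digraph on vertex set Fin size.  The arc relation is Bool-valued,
-- so there are no parallel arcs; loops are forbidden; directed 2-cycles allowed.
record Digraph : Set where
  field
    size     : ℕ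
    arc      : Fin size → Fin size → Bool
    loopless : ∀ v → arc v v ≡ false
open Digraph public

Vertex : Digraph → Set
Vertex D = Fin (size D)

Arc : (D : Digraph) → Vertex D → Vertex D → Set
Arc D u v = T (arc D u v)

outdeg : (D : Digraph) → Vertex D → ℕ
outdeg D v = length (filter (λ w → Data.Bool._≟_ (arc D v w) true) (allFin (size D)))

MinOutdegAtLeast : Digraph → ℕ → Set
MinOutdegAtLeast D c = ∀ v → c ≤ outdeg D v

IsPath : (D : Digraph) → Vertex D → List (Vertex D) → Vertex D → Set
IsPath D x I y = Linked (Arc D) ((x ∷ I) ∷ʳ y) × Unique ((x ∷ I) ∷ʳ y)

-- D − S contains a subdivision of F, where S is a list of vertices of D:
-- branch vertices φ (injective), for each arc (u,v) of F a directed
-- (φ u , φ v)-path with internal vertex list P u v a; internal vertices are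
-- not branch vertices, paths of distinct arcs are internally disjoint,
-- and no vertex used lies in S.
ContainsSubdivAvoiding : (D : Digraph) → List (Vertex D) → Digraph → Set
ContainsSubdivAvoiding D S F =
  Σ (Vertex F → Vertex D) λ φ →
  Σ ((u v : Vertex F) → Arc F u v → List (Vertex D)) λ P →
    Injective _≡_ _≡_ φ
  × (∀ u → φ u ∉ S)
  × (∀ u v (a : Arc F u v) → IsPath D (φ u) (P u v a) (φ v))
  × (∀ u v (a : Arc F u v) x → x ∈ P u v a → x ∉ S)
  × (∀ u v (a : Arc F u v) w x → x ∈ P u v a → x ≡ φ w → Data.Empty.⊥)
  × (∀ u v (a : Arc F u v) u' v' (a' : Arc F u' v') →
       ¬ ((u , v) ≡ (u' , v')) → ∀ x → x ∈ P u v a → x ∈ P u' v' a' → Data.Empty.⊥)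
  where import Data.Empty

ContainsSubdiv : Digraph → Digraph → Set
ContainsSubdiv D F = ContainsSubdivAvoiding D [] F

_⊕_ : Digraph → Digraph → Digraph
F ⊕ G = record { size = size F + size G ; arc = a ; loopless = l }
  where
  a : Fin (size F + size G) → Fin (size F + size G) → Bool
  a x y with splitAt (size F) x | splitAt (size F) y
  ... | inj₁ x' | inj₁ y' = arc F x' y'
  ... | inj₂ x' | inj₂ y' = arc G x' y'
  ... | inj₁ _  | inj₂ _  = false
  ... | inj₂ _  | inj₁ _  = false
  l : ∀ v → a v v ≡ false
  l v with splitAt (size F) v
  ... | inj₁ v' = loopless F v'
  ... | inj₂ v' = loopless G v'

emptyDigraph : Digraph
emptyDigraph = record { size = 0 ; arc = λ () ; loopless = λ () }

copies : ℕ → Digraph → Digraph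
copies zero    F = emptyDigraph
copies (suc k) F = F ⊕ copies k F

-- F is δ⁺-maderian (D ranges over nonempty digraphs, for which δ⁺ is defined)
Maderian : Digraph → Set
Maderian F = ∃ λ c → ∀ (D : Digraph) → 0 < size D →
  MinOutdegAtLeast D c → ContainsSubdiv D F

ErdosPosa : Digraph → Set
ErdosPosa F = ∀ k → 1 ≤ k → ∃ λ p → ∀ (D : Digraph) →
  ContainsSubdiv D (copies k F)
  ⊎ Σ (List (Vertex D)) λ S → length S ≤ p × ¬ ContainsSubdivAvoiding D S F

module Submission where

-- If δ⁺(D) ≥ p + c + 1, where c = mad_δ⁺(F) and p is the Erdős–Pósa bound for k copies,
-- then no set S of at most p vertices meets every subdivision of F: deleting a vertex
-- lowers out-degrees by at most one, so D − S still has δ⁺ ≥ c + 1, and it is nonempty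
-- because a loopless digraph with δ⁺ ≥ 1 has more vertices than any out-degree.
-- Hence D − S contains a subdivision of F, and the Erdős–Pósa dichotomy yields k × F.

open import Defs
open import Data.Nat.Base using (ℕ; zero; suc; _+_; _≤_; _<_; z≤n; s≤s)
open import Data.Nat.Properties
  using (≤-refl; ≤-trans; ≤-pred; n≤1+n; m≤n+m; m≤n⇒m≤1+n; +-mono-≤; +-monoˡ-≤;
         +-commutativeSemigroup; module ≤-Reasoning)
open import Data.Fin.Base using (Fin; punchIn; punchOut)
open import Data.Fin.Properties as Fin using (punchIn-injective; punchInᵢ≢i; punchOut-cong; punchOut-punchIn)
open import Data.Bool.Base using (Bool; true; false)
open import Data.Bool.Properties using (_≟_)
open import Data.Sum.Base using (fromInj₁)
open import Data.Product.Base using (_×_; _,_)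
open import Data.List.Base using (List; []; _∷_; [_]; length; filter; map; tabulate)
open import Data.List.Properties using (map-++)
open import Data.List.Membership.Propositional using (_∈_)
open import Data.List.Membership.Propositional.Properties using (∈-map⁻)
open import Data.List.Relation.Unary.Any using (here; there)
open import Data.List.Relation.Unary.Linked as Linked using (Linked)
import Data.List.Relation.Unary.Linked.Properties as Linked
open import Data.List.Relation.Unary.Unique.Propositional using (Unique)
import Data.List.Relation.Unary.Unique.Propositional.Properties as Unique
open import Data.Empty using (⊥-elim)
open import Algebra.Properties.CommutativeSemigroup +-commutativeSemigroup using (x∙yz≈y∙xz)
open import Function.Base using (_∘_; id)
open import Function.Definitions using (Injective)
open import Relation.Binary.PropositionalEquality using (_≡_; refl; sym; trans; cong; subst; module ≡-Reasoning)
open import Relation.Nullary.Decidable.Core using (yes; no)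

Bool→ℕ : Bool → ℕ
Bool→ℕ true  = 1
Bool→ℕ false = 0

Bool→ℕ-≤ : ∀ b → Bool→ℕ b ≤ 1
Bool→ℕ-≤ true  = ≤-refl
Bool→ℕ-≤ false = z≤n

count : ∀ {n} → (Fin n → Bool) → ℕ
count {zero}  f = 0
count {suc n} f = Bool→ℕ (f Fin.zero) + count (f ∘ Fin.suc)

count-≤ : ∀ {n} (f : Fin n → Bool) → count f ≤ n
count-≤ {zero}  f = z≤n
count-≤ {suc n} f = +-mono-≤ (Bool→ℕ-≤ (f Fin.zero)) (count-≤ (f ∘ Fin.suc))

count-punchIn : ∀ {n} (s : Fin (suc n)) (f : Fin (suc n) → Bool) →
                count f ≡ Bool→ℕ (f s) + count (f ∘ punchIn s)
count-punchIn Fin.zero f = refl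
count-punchIn {suc n} (Fin.suc s) f = begin
  Bool→ℕ (f Fin.zero) + count (f ∘ Fin.suc)
    ≡⟨ cong (Bool→ℕ (f Fin.zero) +_) (count-punchIn s (f ∘ Fin.suc)) ⟩
  Bool→ℕ (f Fin.zero) + (Bool→ℕ (f (Fin.suc s)) + count (f ∘ Fin.suc ∘ punchIn s))
    ≡⟨ x∙yz≈y∙xz (Bool→ℕ (f Fin.zero)) (Bool→ℕ (f (Fin.suc s))) _ ⟩
  Bool→ℕ (f (Fin.suc s)) + count (f ∘ punchIn (Fin.suc s)) ∎
  where open ≡-Reasoning

length-filter-tabulate : ∀ {A : Set} {n} (f : A → Bool) (g : Fin n → A) →
                         length (filter (λ x → f x ≟ true) (tabulate g)) ≡ count (f ∘ g)
length-filter-tabulate {n = zero}  f g = refl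
length-filter-tabulate {n = suc n} f g with f (g Fin.zero)
... | true  = cong suc (length-filter-tabulate f (g ∘ Fin.suc))
... | false = length-filter-tabulate f (g ∘ Fin.suc)

outdeg≡count : (D : Digraph) (v : Vertex D) → outdeg D v ≡ count (arc D v)
outdeg≡count D v = length-filter-tabulate (arc D v) id

induced : (D : Digraph) {m : ℕ} → (Fin m → Vertex D) → Digraph
induced D {m} f = record
  { size = m ; arc = λ i j → arc D (f i) (f j) ; loopless = λ v → loopless D (f v) }

_─_ : (D : Digraph) → Vertex D → Digraph
D@record { size = suc m } ─ s = induced D (punchIn s)

outdeg-< : (D : Digraph) (v : Vertex D) → outdeg D v < size D
outdeg-< record { size = suc m ; arc = a ; loopless = l } v = begin-strict
  outdeg D v                          ≡⟨ outdeg≡count D v ⟩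
  count (arc D v)                     ≡⟨ count-punchIn v (arc D v) ⟩
  Bool→ℕ (arc D v v) + count (arc D v ∘ punchIn v)
                                      ≡⟨ cong (λ b → Bool→ℕ b + count (arc D v ∘ punchIn v)) (loopless D v) ⟩
  count (arc D v ∘ punchIn v)         <⟨ s≤s (count-≤ _) ⟩
  suc m                               ∎
  where
  open ≤-Reasoning
  D = record { size = suc m ; arc = a ; loopless = l }

minOutdeg-─ : ∀ {c} (D : Digraph) (s : Vertex D) →
              MinOutdegAtLeast D (suc c) → MinOutdegAtLeast (D ─ s) c
minOutdeg-─ {c} record { size = suc m ; arc = arc′ ; loopless = l } s δ i = ≤-pred (begin
  suc c                                ≤⟨ δ (punchIn s i) ⟩
  outdeg D (punchIn s i)               ≡⟨ outdeg≡count D (punchIn s i) ⟩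
  count a                              ≡⟨ count-punchIn s a ⟩
  Bool→ℕ (a s) + count (a ∘ punchIn s) ≤⟨ +-monoˡ-≤ _ (Bool→ℕ-≤ (a s)) ⟩
  suc (count (a ∘ punchIn s))          ≡⟨ cong suc (sym (outdeg≡count (D ─ s) i)) ⟩
  suc (outdeg (D ─ s) i)               ∎)
  where
  open ≤-Reasoning
  D = record { size = suc m ; arc = arc′ ; loopless = l }
  a = arc D (punchIn s i)

punchOutAll : ∀ {m} → Fin (suc m) → List (Fin (suc m)) → List (Fin m)
punchOutAll s [] = []
punchOutAll s (x ∷ xs) with s Fin.≟ x
... | yes _   = punchOutAll s xs
... | no s≢x = punchOut s≢x ∷ punchOutAll s xs

length-punchOutAll : ∀ {m} (s : Fin (suc m)) xs → length (punchOutAll s xs) ≤ length xs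
length-punchOutAll s [] = z≤n
length-punchOutAll s (x ∷ xs) with s Fin.≟ x
... | yes _ = m≤n⇒m≤1+n (length-punchOutAll s xs)
... | no _  = s≤s (length-punchOutAll s xs)

∈-punchOutAll : ∀ {m} (s : Fin (suc m)) xs y → punchIn s y ∈ xs → y ∈ punchOutAll s xs
∈-punchOutAll s (x ∷ xs) y (here y≡x) with s Fin.≟ x
... | yes s≡x = ⊥-elim (punchInᵢ≢i s y (trans y≡x (sym s≡x)))
... | no s≢x  = here (trans (sym (punchOut-punchIn s)) (punchOut-cong s y≡x))
∈-punchOutAll s (x ∷ xs) y (there y∈xs) with s Fin.≟ x
... | yes _ = ∈-punchOutAll s xs y y∈xs
... | no _  = there (∈-punchOutAll s xs y y∈xs)

containsSubdivAvoiding-embed :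
  ∀ {D′ D G S T} (f : Vertex D′ → Vertex D) → Injective _≡_ _≡_ f →
  (∀ {x y} → Arc D′ x y → Arc D (f x) (f y)) → (∀ y → f y ∈ T → y ∈ S) →
  ContainsSubdivAvoiding D′ S G → ContainsSubdivAvoiding D T G
containsSubdivAvoiding-embed {D = D} f f-inj f-arc f-reflects-T
  (φ , P , φ-inj , φ-avoids , P-path , P-avoids , P-internal , P-disjoint) =
  f ∘ φ , fP , φ-inj ∘ f-inj , (λ u → φ-avoids u ∘ f-reflects-T (φ u)) , fP-path ,
  fP-avoids , fP-internal , fP-disjoint
  where
  fP = λ u v e → map f (P u v e)

  fP-path = λ u v e → let (linked , unique) = P-path u v e in
    subst (λ L → Linked (Arc D) L × Unique L) (map-++ f (φ u ∷ P u v e) [ φ v ])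
          (Linked.map⁺ (Linked.map f-arc linked) , Unique.map⁺ f-inj unique)

  fP-avoids = λ u v e x x∈fP x∈T → let (y , y∈P , x≡fy) = ∈-map⁻ f x∈fP in
    P-avoids u v e y y∈P (f-reflects-T y (subst (_∈ _) x≡fy x∈T))

  fP-internal = λ u v e w x x∈fP x≡fφw → let (y , y∈P , x≡fy) = ∈-map⁻ f x∈fP in
    P-internal u v e w y y∈P (f-inj (trans (sym x≡fy) x≡fφw))

  fP-disjoint = λ u v e u′ v′ e′ uv≢u′v′ x x∈fP x∈fP′ →
    let (y , y∈P , x≡fy) = ∈-map⁻ f x∈fP
        (y′ , y′∈P′ , x≡fy′) = ∈-map⁻ f x∈fP′
    in P-disjoint u v e u′ v′ e′ uv≢u′v′ y y∈P
         (subst (_∈ P u′ v′ e′) (f-inj (trans (sym x≡fy′) x≡fy)) y′∈P′)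

module _ (G : Digraph) (c : ℕ)
         (maderian : ∀ D → 0 < size D → MinOutdegAtLeast D c → ContainsSubdiv D G) where

  -- Induction on the bound n, since neither D ─ s nor punchOutAll s S is structurally smaller.
  containsSubdivAvoiding : ∀ n D (S : List (Vertex D)) → length S ≤ n → 0 < size D →
                           MinOutdegAtLeast D (n + suc c) → ContainsSubdivAvoiding D S G
  containsSubdivAvoiding n D [] _ D≢∅ δ =
    maderian D D≢∅ (λ v → ≤-trans (≤-trans (n≤1+n c) (m≤n+m (suc c) n)) (δ v))
  containsSubdivAvoiding (suc n) record { size = suc m ; arc = a ; loopless = l } (s ∷ S) |s∷S|≤1+n _ δ =
    containsSubdivAvoiding-embed {D′ = D ─ s} {D} {G} (punchIn s) (punchIn-injective s _ _) id punchIn∈s∷S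
      (containsSubdivAvoiding n (D ─ s) (punchOutAll s S)
        (≤-trans (length-punchOutAll s S) (≤-pred |s∷S|≤1+n)) D─s≢∅ (minOutdeg-─ D s δ))
    where
    D = record { size = suc m ; arc = a ; loopless = l }

    punchIn∈s∷S : ∀ y → punchIn s y ∈ s ∷ S → y ∈ punchOutAll s S
    punchIn∈s∷S y (here s′≡s) = ⊥-elim (punchInᵢ≢i s y s′≡s)
    punchIn∈s∷S y (there y∈S) = ∈-punchOutAll s S y y∈S

    D─s≢∅ : 0 < m
    D─s≢∅ = ≤-trans (≤-trans (s≤s z≤n) (δ s)) (≤-pred (outdeg-< D s))

theorem8 : (F : Defs.Digraph) → Maderian F → ErdosPosa F →
    ∀ k → 1 ≤ k → Maderian (copies k F)
theorem8 F (c , maderian) erdosPosa k k≥1 =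
  let (p , dichotomy) = erdosPosa k k≥1 in
  p + suc c , λ D D≢∅ δ → fromInj₁
    (λ (S , |S|≤p , ¬avoids) → ⊥-elim (¬avoids (containsSubdivAvoiding F c maderian p D S |S|≤p D≢∅ δ)))
    (dichotomy D)
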